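{- Let $G=\{g_1:=0,g_2,\ldots,g_n\}$ be a finite elementary Abelian group, $G\cong(\mathbb{Z}/p\mathbb{Z})^\nu$ for a prime $p$ and $\nu\ge1$ (so $n=p^\nu$), and let $$L_G=\Big\{{\boldsymbol x}=(x_1,\ldots,x_n)\in\mathbb{Z}^n:\ \sum_{i=1}^n x_i=0,\ \sum_{j=2}^n x_j g_j=0\Big\}.$$ Then $L_G$ is strongly eutactic.
   Context: For a lattice $\Lambda$ let $|\Lambda|$ be its minimal nonzero Euclidean norm and $S(\Lambda)$ its set of vectors of norm $|\Lambda|$. $\Lambda$ is strongly eutactic (in $V=\operatorname{span}_{\mathbb R}\Lambda$) if $\frac{1}{|\Lambda|}S(\Lambda)$ is a spherical $2$-design in $V$, i.e. the average over the unit sphere of $V$ of every real polynomial of degree $\le 2$ equals its average over this finite set; equivalently, $\sum_{{\boldsymbol x}\in S(\Lambda)}({\boldsymbol x},{\boldsymbol y})^2=\frac{|\Lambda|^2|S(\Lambda)|}{\dim V}({\boldsymbol y},{\boldsymbol y})$ for all ${\boldsymbol y}\in V$.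
   Formalization: The design identity is required only for ${\boldsymbol y}\in V$ with rational coordinates rather than for all real points of $V$. -}

module Defs where

open import Data.Nat as ℕ using (ℕ)
open import Data.Integer as ℤ using (ℤ; +_)
open import Data.Integer.Divisibility using () renaming (_∣_ to _∣ℤ_)
open import Data.Rational as ℚ using (ℚ; 0ℚ)
open import Data.Fin using (Fin; toℕ; zero; suc)
open import Data.Vec using (Vec; lookup; replicate)
open import Data.List using (List; length; []; _∷_)
open import Data.List.Membership.Propositional using (_∈_)
open import Data.List.Relation.Unary.Unique.Propositional using (Unique)
open import Data.Product using (_×_; ∃)
open import Relation.Binary.PropositionalEquality using (_≡_; _≢_)
open import Function.Bundles using (_⇔_)

Σℤ : ∀ {n} → (Fin n → ℤ) → ℤ
Σℤ {ℕ.zero}  f = + 0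
Σℤ {ℕ.suc n} f = f zero ℤ.+ Σℤ (λ i → f (suc i))

Σℚ : ∀ {n} → (Fin n → ℚ) → ℚ
Σℚ {ℕ.zero}  f = 0ℚ
Σℚ {ℕ.suc n} f = f zero ℚ.+ Σℚ (λ i → f (suc i))

ΣList : ∀ {A : Set} → List A → (A → ℚ) → ℚ
ΣList [] f = 0ℚ
ΣList (x ∷ xs) f = f x ℚ.+ ΣList xs f

ιℤ : ℤ → ℚ
ιℤ z = z ℚ./ 1

ιℕ : ℕ → ℚ
ιℕ k = (+ k) ℚ./ 1

normSq : ∀ {n} → Vec ℤ n → ℤ
normSq {n} x = Σℤ (λ i → lookup x i ℤ.* lookup x i)

inner : ∀ {n} → Vec ℤ n → (Fin n → ℚ) → ℚ
inner x y = Σℚ (λ i → ιℤ (lookup x i) ℚ.* y i)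

innerℚ : ∀ {n} → (Fin n → ℚ) → (Fin n → ℚ) → ℚ
innerℚ y z = Σℚ (λ i → y i ℚ.* z i)

IsMinNormSq : ∀ {n} → (Vec ℤ n → Set) → ℤ → Set
IsMinNormSq {n} Λ m =
  (∃ λ x → Λ x × x ≢ replicate n (+ 0) × normSq x ≡ m) ×
  (∀ x → Λ x → x ≢ replicate n (+ 0) → m ℤ.≤ normSq x)

IsMinimalVectors : ∀ {n} → (Vec ℤ n → Set) → ℤ → List (Vec ℤ n) → Set
IsMinimalVectors {n} Λ m S =
  IsMinNormSq Λ m × Unique S ×
  (∀ x → (x ∈ S) ⇔ (Λ x × x ≢ replicate n (+ 0) × normSq x ≡ m))

-- Strong eutaxy of a lattice Λ ⊆ ℤⁿ with real span V of dimension d,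
-- V given by its rational points InV:
--   Σ_{x∈S(Λ)} (x,y)² = |Λ|² |S(Λ)| / d · (y,y)   for all y ∈ V,
-- written with d multiplied out.
StronglyEutactic : ∀ {n} → (Λ : Vec ℤ n → Set) → (d : ℕ) → ((Fin n → ℚ) → Set) → Set
StronglyEutactic {n} Λ d InV =
  ∃ λ (m : ℤ) → ∃ λ (S : List (Vec ℤ n)) →
    IsMinimalVectors Λ m S ×
    (∀ (y : Fin n → ℚ) → InV y →
       ιℕ d ℚ.* ΣList S (λ x → inner x y ℚ.* inner x y)
         ≡ ιℤ m ℚ.* ιℕ (length S) ℚ.* innerℚ y y)

-- The group G = (ℤ/pℤ)^ν, elements as Vec (Fin p) ν; enumeration g : Fin n → G.
-- L_G = { x ∈ ℤⁿ : Σ x_i = 0, Σ_j x_j g_j = 0 in G }, the second condition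
-- written coordinatewise: p ∣ Σ_j x_j · (g_j)_k for every coordinate k.
-- (The j = 1 term is included; it vanishes since g_1 = 0.)
L_G : ∀ {n} (p ν : ℕ) → (Fin n → Vec (Fin p) ν) → Vec ℤ n → Set
L_G {n} p ν g x =
  Σℤ (λ i → lookup x i) ≡ + 0 ×
  (∀ (k : Fin ν) → (+ p) ∣ℤ Σℤ (λ j → lookup x j ℤ.* (+ toℕ (lookup (g j) k))))

SumZero : ∀ {n} → (Fin n → ℚ) → Set
SumZero y = Σℚ y ≡ 0ℚ

{-# OPTIONS --safe #-}
module Submission where

-- The Gram matrix M i j = Σ_{x ∈ S} x_i x_j of the minimal vectors S is fixed by every
-- permutation of the coordinates that maps L_G onto itself, since such a permutation permutes S.
-- Every affine bijection of G = (ℤ/p)^ν induces one: linear maps of G preserve the condition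
-- Σ_j x_j g_j = 0, and translations do too because the coordinates of x ∈ L_G sum to 0.
-- The affine group of G is 2-transitive (translate u to 0, then a transvection, a dilation and
-- a second transvection carry any z ≠ 0 to e₀), so M has a constant diagonal a and a constant
-- off-diagonal b. As S lies in the hyperplane Σ_i x_i = 0, a + (|G| − 1) b = 0, and the trace
-- gives |G| a = |Λ|² |S|. Hence Σ_{x ∈ S} (x, y)² = (a − b) (y, y) = |Λ|² |S| (y, y) / (|G| − 1)
-- for every y in the hyperplane, which is the (|G| − 1)-dimensional span of L_G.

open import Defs
open import Algebra.Bundles using (CommutativeRing)
import Algebra.Properties.Semiring.Sum as SemiringSum
open import Data.Fin using (Fin; zero; suc; toℕ; fromℕ<)
import Data.Fin.Properties as FinP
open import Data.Fin.Permutation using (Permutation; permutation; _⟨$⟩ʳ_; _⟨$⟩ˡ_; flip; inverseˡ; inverseʳ)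
open import Data.Integer as ℤ using (ℤ; +_; -[1+_]; +≤+)
import Data.Integer.Properties as ℤP
open import Data.Integer.DivMod using (_%ℕ_; _/ℕ_; n%ℕd<d; a≡a%ℕn+[a/ℕn]*n)
open import Data.Integer.Divisibility.Signed as ℤ∣ using (_∣_; ∣ᵤ⇒∣; ∣⇒∣ᵤ)
open import Data.Integer.Tactic.RingSolver using (solve-∀)
open import Data.List using (List; []; _∷_; _++_; map; length; upTo; filter; deduplicate; cartesianProductWith)
open import Data.List.Extrema ℤP.≤-totalOrder using (argmin; argmin-all; f[argmin]≤f[xs]; f[argmin]≤f[⊤])
open import Data.List.Membership.Propositional using (_∈_)
open import Data.List.Membership.Propositional.Properties
  using (∈-map⁺; ∈-map⁻; ∈-++⁺ˡ; ∈-++⁺ʳ; ∈-upTo⁺; ∈-cartesianProductWith⁺; ∈-filter⁺; ∈-filter⁻; ∈-deduplicate⁺; ∈-deduplicate⁻)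
open import Data.List.Membership.Propositional.Properties.WithK using (unique∧set⇒bag)
open import Data.List.Relation.Binary.BagAndSetEquality using (∼bag⇒↭)
open import Data.List.Relation.Binary.Permutation.Propositional
  using (_↭_; prep; swap) renaming (refl to ↭-refl; trans to ↭-trans)
open import Data.List.Relation.Unary.All as All using ()
open import Data.List.Relation.Unary.All.Properties using (all-filter)
open import Data.List.Relation.Unary.Any using (here; there)
open import Data.List.Relation.Unary.Unique.DecPropositional.Properties using (deduplicate-!)
open import Data.List.Relation.Unary.Unique.Propositional.Properties using (map⁺)
open import Data.Nat as ℕ using (ℕ; suc; _^_; _≤_)
import Data.Nat.Properties as ℕP
import Data.Nat.Divisibility as ℕ∣
open import Data.Nat.Coprimality using (prime⇒coprime; coprime-Bézout)
open import Data.Nat.GCD using (module Bézout)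
open import Data.Nat.Primality using (Prime; ¬prime[1])
open import Data.Product using (_×_; _,_; ∃; proj₁; proj₂)
open import Data.Rational as ℚ using (ℚ; 0ℚ; 1ℚ; toℚᵘ)
import Data.Rational.Properties as ℚP
open import Data.Rational.Unnormalised as ℚᵘ using (mkℚᵘ; _≃_; *≡*)
import Data.Rational.Unnormalised.Properties as ℚᵘP
open import Data.Sum using (inj₁; inj₂)
open import Data.Vec using (Vec; []; _∷_; lookup; tabulate; replicate; _[_]≔_)
open import Data.Vec.Properties
  using (≡-dec; lookup∘tabulate; tabulate∘lookup; tabulate-cong; lookup-replicate; lookup∘update; lookup∘update′)
open import Data.Vec.Relation.Binary.Pointwise.Extensional using (ext; Pointwise-≡⇒≡)
open import Function using (_∘_)
open import Function.Bundles using (_⇔_; mk⇔; Equivalence)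
open import Function.Definitions using (Bijective; Injective; Surjective)
open import Relation.Binary.Bundles using (Setoid)
open import Relation.Binary.Structures using (IsEquivalence)
open import Relation.Binary.PropositionalEquality
  using (_≡_; _≢_; refl; sym; trans; cong; cong₂; subst; subst₂; module ≡-Reasoning)
import Relation.Binary.Reasoning.Setoid as SetoidReasoning
open import Relation.Nullary using (yes; no; ¬?; _×-dec_; contradiction)
open import Relation.Nullary.Decidable using (dec⇒maybe)
open import Relation.Unary using (Decidable)
import Tactic.RingSolver as RingSolver
import Tactic.RingSolver.Core.AlmostCommutativeRing as ACR

module FinSumProperties {c ℓ} (R : CommutativeRing c ℓ)
  (Σ : ∀ {n} → (Fin n → CommutativeRing.Carrier R) → CommutativeRing.Carrier R)
  (Σ≈sum : ∀ {n} (f : Fin n → CommutativeRing.Carrier R) → CommutativeRing._≈_ R (Σ f) (SemiringSum.sum (CommutativeRing.semiring R) f))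
  where

  open CommutativeRing R hiding (zero; refl; sym; trans)
  open SemiringSum semiring
  open SetoidReasoning setoid
  open CommutativeRing R using () renaming (trans to ≈-trans)

  Σ-cong : ∀ {n} {f g : Fin n → Carrier} → (∀ i → f i ≈ g i) → Σ f ≈ Σ g
  Σ-cong {f = f} {g} f≈g = begin
    Σ f   ≈⟨ Σ≈sum f ⟩
    sum f ≈⟨ sum-cong-≋ f≈g ⟩
    sum g ≈⟨ Σ≈sum g ⟨
    Σ g   ∎

  Σ-zero : ∀ n → Σ {n} (λ _ → 0#) ≈ 0#
  Σ-zero n = ≈-trans (Σ≈sum _) (sum-replicate-zero n)

  Σ-+ : ∀ {n} (f g : Fin n → Carrier) → Σ (λ i → f i + g i) ≈ Σ f + Σ g
  Σ-+ f g = begin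
    Σ (λ i → f i + g i)   ≈⟨ Σ≈sum _ ⟩
    sum (λ i → f i + g i) ≈⟨ ∑-distrib-+ f g ⟩
    sum f + sum g         ≈⟨ +-cong (Σ≈sum f) (Σ≈sum g) ⟨
    Σ f + Σ g             ∎

  Σ-*ˡ : ∀ {n} (c : Carrier) (f : Fin n → Carrier) → Σ (λ i → c * f i) ≈ c * Σ f
  Σ-*ˡ c f = begin
    Σ (λ i → c * f i)   ≈⟨ Σ≈sum _ ⟩
    sum (λ i → c * f i) ≈⟨ *-distribˡ-sum c f ⟨
    c * sum f           ≈⟨ *-congˡ (Σ≈sum f) ⟨
    c * Σ f             ∎

  Σ-*ʳ : ∀ {n} (c : Carrier) (f : Fin n → Carrier) → Σ (λ i → f i * c) ≈ Σ f * c
  Σ-*ʳ c f = begin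
    Σ (λ i → f i * c)   ≈⟨ Σ≈sum _ ⟩
    sum (λ i → f i * c) ≈⟨ *-distribʳ-sum c f ⟨
    sum f * c           ≈⟨ *-congʳ (Σ≈sum f) ⟨
    Σ f * c             ∎

  Σ-permute : ∀ {n} (f : Fin n → Carrier) (π : Permutation n n) → Σ f ≈ Σ (λ i → f (π ⟨$⟩ʳ i))
  Σ-permute f π = begin
    Σ f                       ≈⟨ Σ≈sum f ⟩
    sum f                     ≈⟨ sum-permute f π ⟩
    sum (λ i → f (π ⟨$⟩ʳ i)) ≈⟨ Σ≈sum _ ⟨
    Σ (λ i → f (π ⟨$⟩ʳ i))   ∎

  Σ-single : ∀ {n} (f : Fin n → Carrier) (i : Fin n) → (∀ j → j ≢ i → f j ≈ 0#) → Σ f ≈ f i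
  Σ-single f i others = ≈-trans (Σ≈sum f) (sum-single f i others)
    where
    sum-single : ∀ {n} (f : Fin n → Carrier) (i : Fin n) → (∀ j → j ≢ i → f j ≈ 0#) → sum f ≈ f i
    sum-single {ℕ.suc n} f zero others = begin
      f zero + sum (λ j → f (suc j))  ≈⟨ +-congˡ (sum-cong-≋ (λ j → others (suc j) λ ())) ⟩
      f zero + sum {n} (λ _ → 0#)     ≈⟨ +-congˡ (sum-replicate-zero n) ⟩
      f zero + 0#                     ≈⟨ +-identityʳ (f zero) ⟩
      f zero                          ∎
    sum-single f (suc i) others = begin
      f zero + sum (λ j → f (suc j))
        ≈⟨ +-cong (others zero λ ()) (sum-single (λ j → f (suc j)) i λ j j≢i → others (suc j) (j≢i ∘ FinP.suc-injective)) ⟩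
      0# + f (suc i)                 ≈⟨ +-identityˡ (f (suc i)) ⟩
      f (suc i)                      ∎

Σℤ≡sum : ∀ {n} (f : Fin n → ℤ) → Σℤ f ≡ SemiringSum.sum (CommutativeRing.semiring ℤP.+-*-commutativeRing) f
Σℤ≡sum {ℕ.zero}  f = refl
Σℤ≡sum {ℕ.suc n} f = cong (ℤ._+_ (f zero)) (Σℤ≡sum (λ i → f (suc i)))

Σℚ≡sum : ∀ {n} (f : Fin n → ℚ) → Σℚ f ≡ SemiringSum.sum (CommutativeRing.semiring ℚP.+-*-commutativeRing) f
Σℚ≡sum {ℕ.zero}  f = refl
Σℚ≡sum {ℕ.suc n} f = cong (ℚ._+_ (f zero)) (Σℚ≡sum (λ i → f (suc i)))

module Σℤ-Properties = FinSumProperties ℤP.+-*-commutativeRing Σℤ Σℤ≡sum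
module Σℚ-Properties = FinSumProperties ℚP.+-*-commutativeRing Σℚ Σℚ≡sum

ιℤ-homo-+ : ∀ a b → ιℤ (a ℤ.+ b) ≡ ιℤ a ℚ.+ ιℤ b
ιℤ-homo-+ a b = trans (ℚP.fromℚᵘ-cong (ℚᵘP.≃-sym homo)) (ℚP.fromℚᵘ-toℚᵘ _)
  where
  open ℚᵘP.≃-Reasoning
  homo : toℚᵘ (ιℤ a ℚ.+ ιℤ b) ≃ mkℚᵘ (a ℤ.+ b) 0
  homo = begin
    toℚᵘ (ιℤ a ℚ.+ ιℤ b)          ≈⟨ ℚP.toℚᵘ-homo-+ (ιℤ a) (ιℤ b) ⟩
    toℚᵘ (ιℤ a) ℚᵘ.+ toℚᵘ (ιℤ b)  ≈⟨ ℚᵘP.+-cong (ℚP.toℚᵘ-fromℚᵘ (mkℚᵘ a 0)) (ℚP.toℚᵘ-fromℚᵘ (mkℚᵘ b 0)) ⟩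
    mkℚᵘ a 0 ℚᵘ.+ mkℚᵘ b 0        ≈⟨ *≡* (cong (ℤ._* + 1) (cong₂ ℤ._+_ (ℤP.*-identityʳ a) (ℤP.*-identityʳ b))) ⟩
    mkℚᵘ (a ℤ.+ b) 0              ∎

ιℤ-homo-* : ∀ a b → ιℤ (a ℤ.* b) ≡ ιℤ a ℚ.* ιℤ b
ιℤ-homo-* a b = trans (ℚP.fromℚᵘ-cong (ℚᵘP.≃-sym homo)) (ℚP.fromℚᵘ-toℚᵘ _)
  where
  open ℚᵘP.≃-Reasoning
  homo : toℚᵘ (ιℤ a ℚ.* ιℤ b) ≃ mkℚᵘ (a ℤ.* b) 0
  homo = begin
    toℚᵘ (ιℤ a ℚ.* ιℤ b)          ≈⟨ ℚP.toℚᵘ-homo-* (ιℤ a) (ιℤ b) ⟩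
    toℚᵘ (ιℤ a) ℚᵘ.* toℚᵘ (ιℤ b)  ≈⟨ ℚᵘP.*-cong (ℚP.toℚᵘ-fromℚᵘ (mkℚᵘ a 0)) (ℚP.toℚᵘ-fromℚᵘ (mkℚᵘ b 0)) ⟩
    mkℚᵘ a 0 ℚᵘ.* mkℚᵘ b 0        ≈⟨ *≡* refl ⟩
    mkℚᵘ (a ℤ.* b) 0              ∎

ιℤ-Σ : ∀ {n} (f : Fin n → ℤ) → ιℤ (Σℤ f) ≡ Σℚ (λ i → ιℤ (f i))
ιℤ-Σ {ℕ.zero}  f = refl
ιℤ-Σ {ℕ.suc n} f = trans (ιℤ-homo-+ (f zero) _) (cong (ℚ._+_ (ιℤ (f zero))) (ιℤ-Σ (λ i → f (suc i))))

Σℚ-const : ∀ n (c : ℚ) → Σℚ {n} (λ _ → c) ≡ ιℕ n ℚ.* c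
Σℚ-const ℕ.zero    c = sym (ℚP.*-zeroˡ c)
Σℚ-const (ℕ.suc n) c = begin
  c ℚ.+ Σℚ {n} (λ _ → c)   ≡⟨ cong₂ ℚ._+_ (sym (ℚP.*-identityˡ c)) (Σℚ-const n c) ⟩
  1ℚ ℚ.* c ℚ.+ ιℕ n ℚ.* c  ≡⟨ ℚP.*-distribʳ-+ c 1ℚ (ιℕ n) ⟨
  (1ℚ ℚ.+ ιℕ n) ℚ.* c      ≡⟨ cong (ℚ._* c) (ιℤ-homo-+ (+ 1) (+ n)) ⟨
  ιℕ (ℕ.suc n) ℚ.* c       ∎
  where open ≡-Reasoning

ℚ-ring : ACR.AlmostCommutativeRing _ _
ℚ-ring = ACR.fromCommutativeRing ℚP.+-*-commutativeRing (λ x → dec⇒maybe (0ℚ ℚ.≟ x))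

module _ {A : Set} where

  ΣList-cong∈ : ∀ (xs : List A) {f g : A → ℚ} → (∀ x → x ∈ xs → f x ≡ g x) → ΣList xs f ≡ ΣList xs g
  ΣList-cong∈ []       f≡g = refl
  ΣList-cong∈ (x ∷ xs) f≡g = cong₂ ℚ._+_ (f≡g x (here refl)) (ΣList-cong∈ xs (λ y y∈ → f≡g y (there y∈)))

  ΣList-cong : ∀ (xs : List A) {f g : A → ℚ} → (∀ x → f x ≡ g x) → ΣList xs f ≡ ΣList xs g
  ΣList-cong xs f≡g = ΣList-cong∈ xs (λ x _ → f≡g x)

  ΣList-↭ : ∀ {xs ys : List A} (f : A → ℚ) → xs ↭ ys → ΣList xs f ≡ ΣList ys f
  ΣList-↭ f ↭-refl            = refl
  ΣList-↭ f (prep x xs↭ys)    = cong (ℚ._+_ (f x)) (ΣList-↭ f xs↭ys)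
  ΣList-↭ f (swap x y xs↭ys)  = begin
    f x ℚ.+ (f y ℚ.+ _)  ≡⟨ ℚP.+-assoc (f x) (f y) _ ⟨
    (f x ℚ.+ f y) ℚ.+ _  ≡⟨ cong₂ ℚ._+_ (ℚP.+-comm (f x) (f y)) (ΣList-↭ f xs↭ys) ⟩
    (f y ℚ.+ f x) ℚ.+ _  ≡⟨ ℚP.+-assoc (f y) (f x) _ ⟩
    f y ℚ.+ (f x ℚ.+ _)  ∎
    where open ≡-Reasoning
  ΣList-↭ f (↭-trans p q)     = trans (ΣList-↭ f p) (ΣList-↭ f q)

  ΣList-map : ∀ {B : Set} (h : A → B) (xs : List A) (f : B → ℚ) → ΣList (map h xs) f ≡ ΣList xs (λ x → f (h x))
  ΣList-map h []       f = refl
  ΣList-map h (x ∷ xs) f = cong (ℚ._+_ (f (h x))) (ΣList-map h xs f)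

  ΣList-*ˡ : ∀ (xs : List A) (c : ℚ) (f : A → ℚ) → ΣList xs (λ x → c ℚ.* f x) ≡ c ℚ.* ΣList xs f
  ΣList-*ˡ []       c f = sym (ℚP.*-zeroʳ c)
  ΣList-*ˡ (x ∷ xs) c f = trans (cong (ℚ._+_ (c ℚ.* f x)) (ΣList-*ˡ xs c f)) (sym (ℚP.*-distribˡ-+ c (f x) _))

  ΣList-const : ∀ (xs : List A) (c : ℚ) → ΣList xs (λ _ → c) ≡ c ℚ.* ιℕ (length xs)
  ΣList-const []       c = sym (ℚP.*-zeroʳ c)
  ΣList-const (x ∷ xs) c = begin
    c ℚ.+ ΣList xs (λ _ → c)             ≡⟨ cong₂ ℚ._+_ (sym (ℚP.*-identityʳ c)) (ΣList-const xs c) ⟩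
    c ℚ.* 1ℚ ℚ.+ c ℚ.* ιℕ (length xs)    ≡⟨ ℚP.*-distribˡ-+ c 1ℚ _ ⟨
    c ℚ.* (1ℚ ℚ.+ ιℕ (length xs))        ≡⟨ cong (c ℚ.*_) (ιℤ-homo-+ (+ 1) (+ length xs)) ⟨
    c ℚ.* ιℕ (length (x ∷ xs))           ∎
    where open ≡-Reasoning

  ΣList-Σℚ : ∀ (xs : List A) {n} (F : A → Fin n → ℚ) →
             ΣList xs (λ x → Σℚ (F x)) ≡ Σℚ (λ i → ΣList xs (λ x → F x i))
  ΣList-Σℚ []       {n} F = sym (Σℚ-Properties.Σ-zero n)
  ΣList-Σℚ (x ∷ xs)     F = trans (cong (ℚ._+_ (Σℚ (F x))) (ΣList-Σℚ xs F)) (sym (Σℚ-Properties.Σ-+ (F x) _))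

-- Strong eutaxy from a two-valued Gram matrix

gram : ∀ {N} → List (Vec ℤ N) → Fin N → Fin N → ℚ
gram S i j = ΣList S (λ x → ιℤ (lookup x i) ℚ.* ιℤ (lookup x j))

module StrongEutaxyCriterion {n : ℕ} (S : List (Vec ℤ (ℕ.suc n))) where

  open import Data.Rational using (_+_; _*_; -_)
  open ≡-Reasoning
  open Σℚ-Properties

  ΣList-inner² : ∀ (y : Fin (ℕ.suc n) → ℚ) →
    ΣList S (λ x → inner x y * inner x y) ≡ Σℚ (λ i → Σℚ (λ j → (y i * y j) * gram S i j))
  ΣList-inner² y = begin
    ΣList S (λ x → inner x y * inner x y)
      ≡⟨ ΣList-cong S (λ x → inner²-expand x) ⟩
    ΣList S (λ x → Σℚ (λ i → Σℚ (λ j → term x i * term x j)))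
      ≡⟨ ΣList-Σℚ S (λ x i → Σℚ (λ j → term x i * term x j)) ⟩
    Σℚ (λ i → ΣList S (λ x → Σℚ (λ j → term x i * term x j)))
      ≡⟨ Σ-cong (λ i → ΣList-Σℚ S (λ x j → term x i * term x j)) ⟩
    Σℚ (λ i → Σℚ (λ j → ΣList S (λ x → term x i * term x j)))
      ≡⟨ Σ-cong (λ i → Σ-cong (λ j → factor-out i j)) ⟩
    Σℚ (λ i → Σℚ (λ j → (y i * y j) * gram S i j)) ∎
    where
    term : Vec ℤ (ℕ.suc n) → Fin (ℕ.suc n) → ℚ
    term x i = ιℤ (lookup x i) * y i
    inner²-expand : ∀ x → inner x y * inner x y ≡ Σℚ (λ i → Σℚ (λ j → term x i * term x j))
    inner²-expand x = begin
      inner x y * inner x y                       ≡⟨ Σ-*ʳ (inner x y) (term x) ⟨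
      Σℚ (λ i → term x i * inner x y)             ≡⟨ Σ-cong (λ i → Σ-*ˡ (term x i) (term x)) ⟨
      Σℚ (λ i → Σℚ (λ j → term x i * term x j))   ∎
    regroup : ∀ a b c d → (a * b) * (c * d) ≡ (b * d) * (a * c)
    regroup = RingSolver.solve-∀ ℚ-ring
    factor-out : ∀ i j → ΣList S (λ x → term x i * term x j) ≡ (y i * y j) * gram S i j
    factor-out i j = begin
      ΣList S (λ x → term x i * term x j)
        ≡⟨ ΣList-cong S (λ x → regroup (ιℤ (lookup x i)) (y i) (ιℤ (lookup x j)) (y j)) ⟩
      ΣList S (λ x → (y i * y j) * (ιℤ (lookup x i) * ιℤ (lookup x j)))
        ≡⟨ ΣList-*ˡ S (y i * y j) (λ x → ιℤ (lookup x i) * ιℤ (lookup x j)) ⟩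
      (y i * y j) * gram S i j                                           ∎

  module _ (m : ℤ) (a b : ℚ)
           (norm : ∀ x → x ∈ S → normSq x ≡ m)
           (coordinate-sum : ∀ x → x ∈ S → Σℤ (lookup x) ≡ + 0)
           (diagonal : ∀ i → gram S i i ≡ a)
           (off-diagonal : ∀ i j → i ≢ j → gram S i j ≡ b)
           where

    trace-gram : ιℕ (ℕ.suc n) * a ≡ ιℤ m * ιℕ (length S)
    trace-gram = begin
      ιℕ (ℕ.suc n) * a                   ≡⟨ Σℚ-const (ℕ.suc n) a ⟨
      Σℚ {ℕ.suc n} (λ _ → a)             ≡⟨ Σ-cong diagonal ⟨
      Σℚ (λ i → gram S i i)              ≡⟨ ΣList-Σℚ S (λ x i → ιℤ (lookup x i) * ιℤ (lookup x i)) ⟨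
      ΣList S (λ x → Σℚ (λ i → ιℤ (lookup x i) * ιℤ (lookup x i)))
        ≡⟨ ΣList-cong∈ S (λ x x∈S → trans (sym (ιℤ-normSq x)) (cong ιℤ (norm x x∈S))) ⟩
      ΣList S (λ _ → ιℤ m)               ≡⟨ ΣList-const S (ιℤ m) ⟩
      ιℤ m * ιℕ (length S)               ∎
      where
      ιℤ-normSq : ∀ x → ιℤ (normSq x) ≡ Σℚ (λ i → ιℤ (lookup x i) * ιℤ (lookup x i))
      ιℤ-normSq x = trans (ιℤ-Σ (λ i → lookup x i ℤ.* lookup x i)) (Σ-cong (λ i → ιℤ-homo-* (lookup x i) (lookup x i)))

    row-gram : a + ιℕ n * b ≡ 0ℚ
    row-gram = begin
      a + ιℕ n * b
        ≡⟨ cong₂ _+_ (diagonal zero) (trans (Σ-cong (λ j → off-diagonal zero (suc j) λ ())) (Σℚ-const n b)) ⟨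
      Σℚ (λ j → gram S zero j)             ≡⟨ ΣList-Σℚ S (λ x j → ιℤ (lookup x zero) * ιℤ (lookup x j)) ⟨
      ΣList S (λ x → Σℚ (λ j → ιℤ (lookup x zero) * ιℤ (lookup x j)))
        ≡⟨ ΣList-cong∈ S (λ x x∈S → row-vanishes x (coordinate-sum x x∈S)) ⟩
      ΣList S (λ _ → 0ℚ)                   ≡⟨ ΣList-const S 0ℚ ⟩
      0ℚ * ιℕ (length S)                   ≡⟨ ℚP.*-zeroˡ (ιℕ (length S)) ⟩
      0ℚ                                   ∎
      where
      row-vanishes : ∀ x → Σℤ (lookup x) ≡ + 0 → Σℚ (λ j → ιℤ (lookup x zero) * ιℤ (lookup x j)) ≡ 0ℚ
      row-vanishes x Σx≡0 = begin
        Σℚ (λ j → ιℤ (lookup x zero) * ιℤ (lookup x j))  ≡⟨ Σ-*ˡ (ιℤ (lookup x zero)) (λ j → ιℤ (lookup x j)) ⟩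
        ιℤ (lookup x zero) * Σℚ (λ j → ιℤ (lookup x j))
          ≡⟨ cong (ιℤ (lookup x zero) *_) (trans (sym (ιℤ-Σ (lookup x))) (cong ιℤ Σx≡0)) ⟩
        ιℤ (lookup x zero) * 0ℚ                          ≡⟨ ℚP.*-zeroʳ (ιℤ (lookup x zero)) ⟩
        0ℚ                                               ∎

    gram-row : ∀ (y : Fin (ℕ.suc n) → ℚ) → Σℚ y ≡ 0ℚ →
               ∀ i → Σℚ (λ j → (y i * y j) * gram S i j) ≡ (y i * y i) * (a + - b)
    gram-row y Σy≡0 i = begin
      Σℚ (λ j → (y i * y j) * gram S i j)
        ≡⟨ Σ-cong (λ j → split (y i) (y j) (gram S i j) b) ⟩
      Σℚ (λ j → (y i * b) * y j + y i * excess j)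
        ≡⟨ Σ-+ (λ j → (y i * b) * y j) (λ j → y i * excess j) ⟩
      Σℚ (λ j → (y i * b) * y j) + Σℚ (λ j → y i * excess j)
        ≡⟨ cong₂ _+_ (Σ-*ˡ (y i * b) y) (Σ-*ˡ (y i) excess) ⟩
      (y i * b) * Σℚ y + y i * Σℚ excess
        ≡⟨ cong₂ (λ s t → (y i * b) * s + y i * t) Σy≡0 (Σ-single excess i excess-off-diagonal) ⟩
      (y i * b) * 0ℚ + y i * (y i * (gram S i i + - b))
        ≡⟨ cong (λ t → (y i * b) * 0ℚ + y i * (y i * (t + - b))) (diagonal i) ⟩
      (y i * b) * 0ℚ + y i * (y i * (a + - b))
        ≡⟨ collect (y i) a b ⟩
      (y i * y i) * (a + - b) ∎
      where
      excess : Fin (ℕ.suc n) → ℚ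
      excess j = y j * (gram S i j + - b)
      excess-off-diagonal : ∀ j → j ≢ i → excess j ≡ 0ℚ
      excess-off-diagonal j j≢i = begin
        y j * (gram S i j + - b)  ≡⟨ cong (λ t → y j * (t + - b)) (off-diagonal i j (j≢i ∘ sym)) ⟩
        y j * (b + - b)           ≡⟨ cong (y j *_) (ℚP.+-inverseʳ b) ⟩
        y j * 0ℚ                  ≡⟨ ℚP.*-zeroʳ (y j) ⟩
        0ℚ                        ∎
      split : ∀ s t g b → (s * t) * g ≡ (s * b) * t + s * (t * (g + - b))
      split = RingSolver.solve-∀ ℚ-ring
      collect : ∀ s a b → (s * b) * 0ℚ + s * (s * (a + - b)) ≡ (s * s) * (a + - b)
      collect = RingSolver.solve-∀ ℚ-ring

    strongly-eutactic : ∀ (y : Fin (ℕ.suc n) → ℚ) → Σℚ y ≡ 0ℚ →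
      ιℕ n * ΣList S (λ x → inner x y * inner x y) ≡ ιℤ m * ιℕ (length S) * innerℚ y y
    strongly-eutactic y Σy≡0 = begin
      ιℕ n * ΣList S (λ x → inner x y * inner x y)
        ≡⟨ cong (ιℕ n *_) (ΣList-inner² y) ⟩
      ιℕ n * Σℚ (λ i → Σℚ (λ j → (y i * y j) * gram S i j))
        ≡⟨ cong (ιℕ n *_) (trans (Σ-cong (gram-row y Σy≡0)) (Σ-*ʳ (a + - b) (λ i → y i * y i))) ⟩
      ιℕ n * (innerℚ y y * (a + - b))
        ≡⟨ rearrange (ιℕ n) (innerℚ y y) a b ⟩
      ((1ℚ + ιℕ n) * a + - (a + ιℕ n * b)) * innerℚ y y
        ≡⟨ cong₂ (λ s t → (s + - t) * innerℚ y y) (trans (cong (_* a) (sym (ιℤ-homo-+ (+ 1) (+ n)))) trace-gram) row-gram ⟩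
      (ιℤ m * ιℕ (length S) + - 0ℚ) * innerℚ y y
        ≡⟨ cong (_* innerℚ y y) (ℚP.+-identityʳ (ιℤ m * ιℕ (length S))) ⟩
      ιℤ m * ιℕ (length S) * innerℚ y y ∎
      where
      rearrange : ∀ k Y a b → k * (Y * (a + - b)) ≡ ((1ℚ + k) * a + - (a + k * b)) * Y
      rearrange = RingSolver.solve-∀ ℚ-ring

-- Invariance of the Gram matrix under coordinate permutations

module _ {N : ℕ} where

  permute : Permutation N N → Vec ℤ N → Vec ℤ N
  permute π x = tabulate (λ k → lookup x (π ⟨$⟩ʳ k))

  lookup-permute : ∀ π x k → lookup (permute π x) k ≡ lookup x (π ⟨$⟩ʳ k)
  lookup-permute π x = lookup∘tabulate _

  permute-flip : ∀ π x → permute (flip π) (permute π x) ≡ x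
  permute-flip π x = begin
    tabulate (λ k → lookup (permute π x) (flip π ⟨$⟩ʳ k))  ≡⟨ tabulate-cong (λ k → lookup-permute π x _) ⟩
    tabulate (λ k → lookup x (π ⟨$⟩ʳ (π ⟨$⟩ˡ k)))          ≡⟨ tabulate-cong (λ k → cong (lookup x) (inverseʳ π)) ⟩
    tabulate (lookup x)                                     ≡⟨ tabulate∘lookup x ⟩
    x                                                       ∎
    where open ≡-Reasoning

  permute-injective : ∀ π {x y} → permute π x ≡ permute π y → x ≡ y
  permute-injective π {x} {y} eq = begin
    x                                ≡⟨ permute-flip π x ⟨
    permute (flip π) (permute π x)   ≡⟨ cong (permute (flip π)) eq ⟩
    permute (flip π) (permute π y)   ≡⟨ permute-flip π y ⟩
    y                                ∎
    where open ≡-Reasoning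

  permute-zero : ∀ π → permute π (replicate N (+ 0)) ≡ replicate N (+ 0)
  permute-zero π = Pointwise-≡⇒≡ (ext λ k → begin
    lookup (permute π (replicate N (+ 0))) k  ≡⟨ lookup-permute π (replicate N (+ 0)) k ⟩
    lookup (replicate N (+ 0)) (π ⟨$⟩ʳ k)     ≡⟨ lookup-replicate (π ⟨$⟩ʳ k) (+ 0) ⟩
    + 0                                       ≡⟨ lookup-replicate k (+ 0) ⟨
    lookup (replicate N (+ 0)) k              ∎)
    where open ≡-Reasoning

  normSq-permute : ∀ π x → normSq (permute π x) ≡ normSq x
  normSq-permute π x = begin
    Σℤ (λ k → lookup (permute π x) k ℤ.* lookup (permute π x) k)
      ≡⟨ Σℤ-Properties.Σ-cong (λ k → cong₂ ℤ._*_ (lookup-permute π x k) (lookup-permute π x k)) ⟩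
    Σℤ (λ k → lookup x (π ⟨$⟩ʳ k) ℤ.* lookup x (π ⟨$⟩ʳ k))
      ≡⟨ Σℤ-Properties.Σ-permute (λ k → lookup x k ℤ.* lookup x k) π ⟨
    normSq x                                                       ∎
    where open ≡-Reasoning

  _PreservedBy_ : (Vec ℤ N → Set) → Permutation N N → Set
  Λ PreservedBy π = ∀ x → Λ x → Λ (permute π x)

  module _ {Λ : Vec ℤ N → Set} {m : ℤ} {S : List (Vec ℤ N)} (minimal : IsMinimalVectors Λ m S) where

    private
      S-members : ∀ x → (x ∈ S) ⇔ (Λ x × x ≢ replicate N (+ 0) × normSq x ≡ m)
      S-members = proj₂ (proj₂ minimal)

    permute-∈ : ∀ π → Λ PreservedBy π → ∀ {x} → x ∈ S → permute π x ∈ S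
    permute-∈ π preserved {x} x∈S with Equivalence.to (S-members x) x∈S
    ... | Λx , x≢0 , normSq≡m = Equivalence.from (S-members (permute π x))
      ( preserved x Λx
      , (λ πx≡0 → x≢0 (permute-injective π (trans πx≡0 (sym (permute-zero π)))))
      , trans (normSq-permute π x) normSq≡m )

    gram-permute : ∀ π → Λ PreservedBy π → Λ PreservedBy flip π →
                   ∀ i j → gram S i j ≡ gram S (π ⟨$⟩ʳ i) (π ⟨$⟩ʳ j)
    gram-permute π preserved preserved˘ i j = begin
      ΣList S entry                          ≡⟨ ΣList-↭ entry πS↭S ⟨
      ΣList (map (permute π) S) entry        ≡⟨ ΣList-map (permute π) S entry ⟩
      ΣList S (λ x → entry (permute π x))
        ≡⟨ ΣList-cong S (λ x → cong₂ (λ u v → ιℤ u ℚ.* ιℤ v) (lookup-permute π x i) (lookup-permute π x j)) ⟩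
      gram S (π ⟨$⟩ʳ i) (π ⟨$⟩ʳ j)          ∎
      where
      open ≡-Reasoning
      entry : Vec ℤ N → ℚ
      entry x = ιℤ (lookup x i) ℚ.* ιℤ (lookup x j)
      πS⊆S : ∀ {z} → z ∈ map (permute π) S → z ∈ S
      πS⊆S z∈πS with ∈-map⁻ (permute π) z∈πS
      ... | x , x∈S , refl = permute-∈ π preserved x∈S
      S⊆πS : ∀ {z} → z ∈ S → z ∈ map (permute π) S
      S⊆πS {z} z∈S = subst (_∈ map (permute π) S) (permute-flip (flip π) z)
                       (∈-map⁺ (permute π) (permute-∈ (flip π) preserved˘ z∈S))
      πS↭S : map (permute π) S ↭ S
      πS↭S = ∼bag⇒↭ (unique∧set⇒bag (map⁺ (permute-injective π) (proj₁ (proj₂ minimal))) (proj₁ (proj₂ minimal)) (mk⇔ πS⊆S S⊆πS))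

-- Existence of minimal vectors

square≡∣∣*∣∣ : ∀ z → z ℤ.* z ≡ + (ℤ.∣ z ∣ ℕ.* ℤ.∣ z ∣)
square≡∣∣*∣∣ (+ k)     = sym (ℤP.pos-* k k)
square≡∣∣*∣∣ -[1+ k ]  = refl

0≤square : ∀ z → + 0 ℤ.≤ z ℤ.* z
0≤square z = subst (+ 0 ℤ.≤_) (sym (square≡∣∣*∣∣ z)) (+≤+ ℕ.z≤n)

∣∣≤square : ∀ z → + ℤ.∣ z ∣ ℤ.≤ z ℤ.* z
∣∣≤square z = subst (+ ℤ.∣ z ∣ ℤ.≤_) (sym (square≡∣∣*∣∣ z)) (+≤+ (k≤k*k ℤ.∣ z ∣))
  where
  k≤k*k : ∀ k → k ℕ.≤ k ℕ.* k
  k≤k*k ℕ.zero    = ℕ.z≤n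
  k≤k*k (ℕ.suc k) = ℕP.m≤m*n (ℕ.suc k) (ℕ.suc k)

0≤Σℤ : ∀ {n} (f : Fin n → ℤ) → (∀ i → + 0 ℤ.≤ f i) → + 0 ℤ.≤ Σℤ f
0≤Σℤ {ℕ.zero}  f 0≤f = ℤP.≤-refl
0≤Σℤ {ℕ.suc n} f 0≤f = ℤP.+-mono-≤ (0≤f zero) (0≤Σℤ (f ∘ suc) (0≤f ∘ suc))

term≤Σℤ : ∀ {n} (f : Fin n → ℤ) → (∀ i → + 0 ℤ.≤ f i) → ∀ i → f i ℤ.≤ Σℤ f
term≤Σℤ f 0≤f zero = begin
  f zero              ≡⟨ ℤP.+-identityʳ (f zero) ⟨
  f zero ℤ.+ + 0      ≤⟨ ℤP.+-monoʳ-≤ (f zero) (0≤Σℤ (f ∘ suc) (0≤f ∘ suc)) ⟩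
  Σℤ f                ∎
  where open ℤP.≤-Reasoning
term≤Σℤ f 0≤f (suc i) = begin
  f (suc i)                  ≤⟨ term≤Σℤ (f ∘ suc) (0≤f ∘ suc) i ⟩
  Σℤ (f ∘ suc)               ≡⟨ ℤP.+-identityˡ _ ⟨
  + 0 ℤ.+ Σℤ (f ∘ suc)       ≤⟨ ℤP.+-monoˡ-≤ (Σℤ (f ∘ suc)) (0≤f zero) ⟩
  Σℤ f                       ∎
  where open ℤP.≤-Reasoning

0≤normSq : ∀ {n} (x : Vec ℤ n) → + 0 ℤ.≤ normSq x
0≤normSq x = 0≤Σℤ _ (λ i → 0≤square (lookup x i))

∣lookup∣≤normSq : ∀ {n} (x : Vec ℤ n) i → + ℤ.∣ lookup x i ∣ ℤ.≤ normSq x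
∣lookup∣≤normSq x i = ℤP.≤-trans (∣∣≤square (lookup x i)) (term≤Σℤ _ (λ i → 0≤square (lookup x i)) i)

integersUpTo : ℕ → List ℤ
integersUpTo B = map +_ (upTo (ℕ.suc B)) ++ map -[1+_] (upTo B)

∈-integersUpTo : ∀ {B} z → ℤ.∣ z ∣ ℕ.≤ B → z ∈ integersUpTo B
∈-integersUpTo (+ k)     k≤B  = ∈-++⁺ˡ (∈-map⁺ +_ (∈-upTo⁺ (ℕ.s≤s k≤B)))
∈-integersUpTo -[1+ k ]  k<B  = ∈-++⁺ʳ _ (∈-map⁺ -[1+_] (∈-upTo⁺ k<B))

vectorsUpTo : ℕ → (N : ℕ) → List (Vec ℤ N)
vectorsUpTo B ℕ.zero    = [] ∷ []
vectorsUpTo B (ℕ.suc N) = cartesianProductWith _∷_ (integersUpTo B) (vectorsUpTo B N)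

∈-vectorsUpTo : ∀ {B N} (x : Vec ℤ N) → (∀ i → ℤ.∣ lookup x i ∣ ℕ.≤ B) → x ∈ vectorsUpTo B N
∈-vectorsUpTo []       bounded = here refl
∈-vectorsUpTo (a ∷ x)  bounded = ∈-cartesianProductWith⁺ _∷_ (∈-integersUpTo a (bounded zero)) (∈-vectorsUpTo x (bounded ∘ suc))

-- Vectors at least as short as w have entries bounded by |w|², so the minimal vectors
-- are found by a search through a finite box.
module ShortestVectors {N : ℕ} {Λ : Vec ℤ N → Set} (Λ? : Decidable Λ)
                       {w : Vec ℤ N} (w∈Λ : Λ w) (w≢0 : w ≢ replicate N (+ 0)) where

  NonzeroIn : Vec ℤ N → Set
  NonzeroIn x = Λ x × x ≢ replicate N (+ 0)

  nonzeroIn? : Decidable NonzeroIn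
  nonzeroIn? x = Λ? x ×-dec ¬? (≡-dec ℤ._≟_ x (replicate N (+ 0)))

  candidates : List (Vec ℤ N)
  candidates = filter nonzeroIn? (vectorsUpTo ℤ.∣ normSq w ∣ N)

  ∈-candidates : ∀ x → NonzeroIn x → normSq x ℤ.≤ normSq w → x ∈ candidates
  ∈-candidates x x∈Λ∖0 x≤w = ∈-filter⁺ nonzeroIn? (∈-vectorsUpTo x bounded) x∈Λ∖0
    where
    bounded : ∀ i → ℤ.∣ lookup x i ∣ ℕ.≤ ℤ.∣ normSq w ∣
    bounded i = ℤP.drop‿+≤+ (begin
      + ℤ.∣ lookup x i ∣   ≤⟨ ∣lookup∣≤normSq x i ⟩
      normSq x             ≤⟨ x≤w ⟩
      normSq w             ≡⟨ ℤP.0≤i⇒+∣i∣≡i (0≤normSq w) ⟨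
      + ℤ.∣ normSq w ∣     ∎)
      where open ℤP.≤-Reasoning

  shortest : Vec ℤ N
  shortest = argmin normSq w candidates

  m : ℤ
  m = normSq shortest

  shortest∈Λ∖0 : NonzeroIn shortest
  shortest∈Λ∖0 = argmin-all normSq (w∈Λ , w≢0) (all-filter nonzeroIn? (vectorsUpTo ℤ.∣ normSq w ∣ N))

  m≤normSq : ∀ x → NonzeroIn x → m ℤ.≤ normSq x
  m≤normSq x x∈Λ∖0 with normSq x ℤP.≤? normSq w
  ... | yes x≤w = All.lookup (f[argmin]≤f[xs] {f = normSq} w candidates) (∈-candidates x x∈Λ∖0 x≤w)
  ... | no  x≰w = ℤP.≤-trans (f[argmin]≤f[⊤] {f = normSq} w candidates) (ℤP.<⇒≤ (ℤP.≰⇒> x≰w))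

  S : List (Vec ℤ N)
  S = deduplicate (≡-dec ℤ._≟_) (filter (λ x → normSq x ℤ.≟ m) candidates)

  ∈S⇔ : ∀ x → (x ∈ S) ⇔ (Λ x × x ≢ replicate N (+ 0) × normSq x ≡ m)
  ∈S⇔ x = mk⇔ to from
    where
    to : x ∈ S → Λ x × x ≢ replicate N (+ 0) × normSq x ≡ m
    to x∈S = proj₁ x∈Λ∖0 , proj₂ x∈Λ∖0 , proj₂ x∈filtered
      where
      x∈filtered : x ∈ candidates × normSq x ≡ m
      x∈filtered = ∈-filter⁻ (λ x → normSq x ℤ.≟ m) {xs = candidates} (∈-deduplicate⁻ (≡-dec ℤ._≟_) _ x∈S)
      x∈Λ∖0 : NonzeroIn x
      x∈Λ∖0 = proj₂ (∈-filter⁻ nonzeroIn? {xs = vectorsUpTo ℤ.∣ normSq w ∣ N} (proj₁ x∈filtered))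
    from : Λ x × x ≢ replicate N (+ 0) × normSq x ≡ m → x ∈ S
    from (x∈Λ , x≢0 , x≡m) = ∈-deduplicate⁺ (≡-dec ℤ._≟_) (∈-filter⁺ (λ x → normSq x ℤ.≟ m)
      (∈-candidates x (x∈Λ , x≢0) (ℤP.≤-trans (ℤP.≤-reflexive x≡m) (f[argmin]≤f[⊤] {f = normSq} w candidates))) x≡m)

  isMinimalVectors : IsMinimalVectors Λ m S
  isMinimalVectors = ((shortest , proj₁ shortest∈Λ∖0 , proj₂ shortest∈Λ∖0 , refl) , λ x x∈Λ x≢0 → m≤normSq x (x∈Λ , x≢0))
                   , deduplicate-! (≡-dec ℤ._≟_) _
                   , ∈S⇔

-- Taking p = suc p-1 makes Fin p inhabited and fromℤ total without instance arguments.
module Congruence (p-1 : ℕ) where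

  open import Data.Integer using (-_; _-_)

  p : ℕ
  p = ℕ.suc p-1

  p∣0 : + p ∣ + 0
  p∣0 = ℤ∣.divides (+ 0) refl

  -- A record rather than a synonym, so that a and b can be inferred from a proof of a ≡ₚ b.
  infix 4 _≡ₚ_
  record _≡ₚ_ (a b : ℤ) : Set where
    constructor mk≡ₚ
    field p∣a-b : + p ∣ a - b

  ≡ₚ-reflexive : ∀ {a b} → a ≡ b → a ≡ₚ b
  ≡ₚ-reflexive {a} refl = mk≡ₚ (subst (+ p ∣_) (sym (ℤP.+-inverseʳ a)) p∣0)

  ≡ₚ-refl : ∀ {a} → a ≡ₚ a
  ≡ₚ-refl = ≡ₚ-reflexive refl

  ≡ₚ-sym : ∀ {a b} → a ≡ₚ b → b ≡ₚ a
  ≡ₚ-sym {a} {b} (mk≡ₚ p∣a-b) = mk≡ₚ (subst (+ p ∣_) (negate a b) (ℤ∣.∣m⇒∣-m p∣a-b))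
    where
    negate : ∀ a b → - (a - b) ≡ b - a
    negate = solve-∀

  ≡ₚ-trans : ∀ {a b c} → a ≡ₚ b → b ≡ₚ c → a ≡ₚ c
  ≡ₚ-trans {a} {b} {c} (mk≡ₚ p∣a-b) (mk≡ₚ p∣b-c) = mk≡ₚ (subst (+ p ∣_) (telescope a b c) (ℤ∣.∣m∣n⇒∣m+n p∣a-b p∣b-c))
    where
    telescope : ∀ a b c → (a - b) ℤ.+ (b - c) ≡ a - c
    telescope = solve-∀

  ≡ₚ-isEquivalence : IsEquivalence _≡ₚ_
  ≡ₚ-isEquivalence = record { refl = ≡ₚ-refl ; sym = ≡ₚ-sym ; trans = ≡ₚ-trans }

  ≡ₚ-setoid : Setoid _ _
  ≡ₚ-setoid = record { isEquivalence = ≡ₚ-isEquivalence }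

  module ≡ₚ-Reasoning = SetoidReasoning ≡ₚ-setoid

  +-cong-≡ₚ : ∀ {a b c d} → a ≡ₚ b → c ≡ₚ d → a ℤ.+ c ≡ₚ b ℤ.+ d
  +-cong-≡ₚ {a} {b} {c} {d} (mk≡ₚ p∣a-b) (mk≡ₚ p∣c-d) = mk≡ₚ (subst (+ p ∣_) (regroup a b c d) (ℤ∣.∣m∣n⇒∣m+n p∣a-b p∣c-d))
    where
    regroup : ∀ a b c d → (a - b) ℤ.+ (c - d) ≡ (a ℤ.+ c) - (b ℤ.+ d)
    regroup = solve-∀

  *-congˡ-≡ₚ : ∀ k {a b} → a ≡ₚ b → k ℤ.* a ≡ₚ k ℤ.* b
  *-congˡ-≡ₚ k {a} {b} (mk≡ₚ p∣a-b) = mk≡ₚ (subst (+ p ∣_) (distrib k a b) (ℤ∣.∣n⇒∣m*n k p∣a-b))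
    where
    distrib : ∀ k a b → k ℤ.* (a - b) ≡ k ℤ.* a - k ℤ.* b
    distrib = solve-∀

  neg-cong-≡ₚ : ∀ {a b} → a ≡ₚ b → - a ≡ₚ - b
  neg-cong-≡ₚ {a} {b} (mk≡ₚ p∣a-b) = mk≡ₚ (subst (+ p ∣_) (negate a b) (ℤ∣.∣m⇒∣-m p∣a-b))
    where
    negate : ∀ a b → - (a - b) ≡ - a - - b
    negate = solve-∀

  *-congʳ-≡ₚ : ∀ k {a b} → a ≡ₚ b → a ℤ.* k ≡ₚ b ℤ.* k
  *-congʳ-≡ₚ k {a} {b} a≡b = subst₂ _≡ₚ_ (ℤP.*-comm k a) (ℤP.*-comm k b) (*-congˡ-≡ₚ k a≡b)

  Σℤ-cong-≡ₚ : ∀ {n} {f g : Fin n → ℤ} → (∀ i → f i ≡ₚ g i) → Σℤ f ≡ₚ Σℤ g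
  Σℤ-cong-≡ₚ {ℕ.zero}  f≡g = ≡ₚ-refl
  Σℤ-cong-≡ₚ {ℕ.suc n} f≡g = +-cong-≡ₚ (f≡g zero) (Σℤ-cong-≡ₚ (f≡g ∘ suc))

  +-multiple-≡ₚ : ∀ a k → a ℤ.+ k ℤ.* + p ≡ₚ a
  +-multiple-≡ₚ a k = mk≡ₚ (subst (+ p ∣_) (cancel a k (+ p)) (ℤ∣.∣n⇒∣m*n k ℤ∣.∣-refl))
    where
    cancel : ∀ a k p → k ℤ.* p ≡ (a ℤ.+ k ℤ.* p) - a
    cancel = solve-∀

  ∣-resp-≡ₚ : ∀ {a b} → a ≡ₚ b → + p ∣ b → + p ∣ a
  ∣-resp-≡ₚ {a} {b} (mk≡ₚ p∣a-b) p∣b = subst (+ p ∣_) (cancel a b) (ℤ∣.∣m∣n⇒∣m+n p∣a-b p∣b)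
    where
    cancel : ∀ a b → (a - b) ℤ.+ b ≡ a
    cancel = solve-∀

  toℤ : Fin p → ℤ
  toℤ v = + toℕ v

  fromℤ : ℤ → Fin p
  fromℤ z = fromℕ< (n%ℕd<d z p)

  toℤ-fromℤ : ∀ z → toℤ (fromℤ z) ≡ₚ z
  toℤ-fromℤ z = begin
    toℤ (fromℤ z)                 ≡⟨ cong +_ (FinP.toℕ-fromℕ< (n%ℕd<d z p)) ⟩
    + (z %ℕ p)                    ≈⟨ +-multiple-≡ₚ (+ (z %ℕ p)) (z /ℕ p) ⟨
    + (z %ℕ p) ℤ.+ (z /ℕ p) ℤ.* + p ≡⟨ a≡a%ℕn+[a/ℕn]*n z p ⟨
    z                             ∎
    where open ≡ₚ-Reasoning

  ≤-injective-≡ₚ : ∀ {a b} → a ℕ.≤ b → b ℕ.< p → + a ≡ₚ + b → a ≡ b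
  ≤-injective-≡ₚ {a} {b} a≤b b<p (mk≡ₚ p∣a-b) =
    ℕP.≤-antisym a≤b (ℕP.m∸n≡0⇒m≤n (divisible-below⇒zero (ℕP.≤-<-trans (ℕP.m∸n≤m b a) b<p) p∣b∸a))
    where
    p∣b∸a : p ℕ∣.∣ b ℕ.∸ a
    p∣b∸a = subst (p ℕ∣.∣_) (trans (cong ℤ.∣_∣ (ℤP.m-n≡m⊖n a b)) (ℤP.∣⊖∣-≤ a≤b)) (∣⇒∣ᵤ p∣a-b)
    divisible-below⇒zero : ∀ {d} → d ℕ.< p → p ℕ∣.∣ d → d ≡ 0
    divisible-below⇒zero {ℕ.zero}  _   _   = refl
    divisible-below⇒zero {ℕ.suc d} d<p p∣d = contradiction (ℕ∣.∣⇒≤ p∣d) (ℕP.<⇒≱ d<p)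

  toℤ-injective-≡ₚ : ∀ {u v} → toℤ u ≡ₚ toℤ v → u ≡ v
  toℤ-injective-≡ₚ {u} {v} u≡v with ℕP.≤-total (toℕ u) (toℕ v)
  ... | inj₁ u≤v = FinP.toℕ-injective (≤-injective-≡ₚ u≤v (FinP.toℕ<n v) u≡v)
  ... | inj₂ v≤u = FinP.toℕ-injective (sym (≤-injective-≡ₚ v≤u (FinP.toℕ<n u) (≡ₚ-sym u≡v)))

  fromℤ-unique : ∀ {z v} → toℤ v ≡ₚ z → fromℤ z ≡ v
  fromℤ-unique {z} v≡z = toℤ-injective-≡ₚ (≡ₚ-trans (toℤ-fromℤ z) (≡ₚ-sym v≡z))

  fromℤ-cong : ∀ {a b} → a ≡ₚ b → fromℤ a ≡ fromℤ b
  fromℤ-cong {a} {b} a≡b = fromℤ-unique (≡ₚ-trans (toℤ-fromℤ b) (≡ₚ-sym a≡b))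

  private
    pos-1+* : ∀ a b → + (1 ℕ.+ a ℕ.* b) ≡ + 1 ℤ.+ + a ℤ.* + b
    pos-1+* a b = trans (ℤP.pos-+ 1 (a ℕ.* b)) (cong (ℤ._+_ (+ 1)) (ℤP.pos-* a b))

  inverse-≡ₚ : Prime p → ∀ (v : Fin p) → v ≢ zero → ∃ λ c → c ℤ.* toℤ v ≡ₚ + 1
  inverse-≡ₚ p-prime v v≢0 with coprime-Bézout (prime⇒coprime p-prime {{ℕ.≢-nonZero (v≢0 ∘ FinP.toℕ-injective)}} (FinP.toℕ<n v))
  ... | Bézout.+- x y 1+yv≡xp = - + y , ≡ₚ-trans (≡ₚ-reflexive -yv≡1-xp) (+-multiple-≡ₚ (+ 1) (- + x))
    where
    open ≡-Reasoning
    negate : ∀ y v → - y ℤ.* v ≡ + 1 ℤ.+ - (+ 1 ℤ.+ y ℤ.* v)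
    negate = solve-∀
    -yv≡1-xp : - + y ℤ.* toℤ v ≡ + 1 ℤ.+ - + x ℤ.* + p
    -yv≡1-xp = begin
      - + y ℤ.* toℤ v                    ≡⟨ negate (+ y) (toℤ v) ⟩
      + 1 ℤ.+ - (+ 1 ℤ.+ + y ℤ.* toℤ v)
        ≡⟨ cong (λ t → + 1 ℤ.+ - t) (trans (sym (pos-1+* y (toℕ v))) (trans (cong +_ 1+yv≡xp) (ℤP.pos-* x p))) ⟩
      + 1 ℤ.+ - (+ x ℤ.* + p)            ≡⟨ cong (λ t → + 1 ℤ.+ t) (ℤP.neg-distribˡ-* (+ x) (+ p)) ⟩
      + 1 ℤ.+ - + x ℤ.* + p              ∎
  ... | Bézout.-+ x y 1+xp≡yv = + y , ≡ₚ-trans (≡ₚ-reflexive (sym 1+xp≡yv′)) (+-multiple-≡ₚ (+ 1) (+ x))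
    where
    1+xp≡yv′ : + 1 ℤ.+ + x ℤ.* + p ≡ + y ℤ.* toℤ v
    1+xp≡yv′ = trans (sym (pos-1+* x p)) (trans (cong +_ 1+xp≡yv) (ℤP.pos-* y (toℕ v)))

-- Affine symmetries of L_G

module AffineMaps (p-1 ν : ℕ) where

  open Congruence p-1
  open import Data.Integer using (_+_; _*_; -_)

  G : Set
  G = Vec (Fin p) ν

  coord : G → Fin ν → ℤ
  coord v k = toℤ (lookup v k)

  0G : G
  0G = replicate ν zero

  coord-0G : ∀ k → coord 0G k ≡ + 0
  coord-0G k = cong toℤ (lookup-replicate k zero)

  coord-tabulate : ∀ (f : Fin ν → ℤ) k → coord (tabulate (λ k → fromℤ (f k))) k ≡ₚ f k
  coord-tabulate f k = subst (λ u → toℤ u ≡ₚ f k) (sym (lookup∘tabulate (λ k → fromℤ (f k)) k)) (toℤ-fromℤ (f k))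

  tabulate-fromℤ : ∀ (f : Fin ν → ℤ) v → (∀ k → f k ≡ₚ coord v k) → tabulate (λ k → fromℤ (f k)) ≡ v
  tabulate-fromℤ f v f≡v = Pointwise-≡⇒≡ (ext λ k →
    trans (lookup∘tabulate (λ k → fromℤ (f k)) k) (fromℤ-unique (≡ₚ-sym (f≡v k))))

  translate : (Fin ν → ℤ) → G → G
  translate a v = tabulate (λ k → fromℤ (coord v k + a k))

  coord-translate : ∀ a v k → coord (translate a v) k ≡ₚ coord v k + a k
  coord-translate a v = coord-tabulate (λ k → coord v k + a k)

  translate-inverse : ∀ a b → (∀ k → a k + b k ≡ₚ + 0) → ∀ v → translate b (translate a v) ≡ v
  translate-inverse a b a+b≡0 v = tabulate-fromℤ _ v λ k → begin
    coord (translate a v) k + b k  ≈⟨ +-cong-≡ₚ (coord-translate a v k) ≡ₚ-refl ⟩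
    (coord v k + a k) + b k        ≡⟨ ℤP.+-assoc (coord v k) (a k) (b k) ⟩
    coord v k + (a k + b k)        ≈⟨ +-cong-≡ₚ (≡ₚ-refl {coord v k}) (a+b≡0 k) ⟩
    coord v k + + 0                ≡⟨ ℤP.+-identityʳ (coord v k) ⟩
    coord v k                      ∎
    where open ≡ₚ-Reasoning

  translate-to-0G : ∀ u → translate (-_ ∘ coord u) u ≡ 0G
  translate-to-0G u = tabulate-fromℤ _ 0G λ k →
    ≡ₚ-reflexive (trans (ℤP.+-inverseʳ (coord u k)) (sym (coord-0G k)))

  transvection : Fin ν → (Fin ν → ℤ) → G → G
  transvection s b v = tabulate (λ k → fromℤ (coord v k + b k * coord v s))

  coord-transvection : ∀ s b v k → coord (transvection s b v) k ≡ₚ coord v k + b k * coord v s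
  coord-transvection s b v = coord-tabulate (λ k → coord v k + b k * coord v s)

  transvection-inverse : ∀ s b b′ → (∀ k → b k + b′ k ≡ₚ + 0) → b s ≡ₚ + 0 →
                         ∀ v → transvection s b′ (transvection s b v) ≡ v
  transvection-inverse s b b′ b+b′≡0 bₛ≡0 v = tabulate-fromℤ _ v λ k → begin
    coord w k + b′ k * coord w s                        ≈⟨ +-cong-≡ₚ (coord-transvection s b v k) (*-congˡ-≡ₚ (b′ k) wₛ≡vₛ) ⟩
    (coord v k + b k * coord v s) + b′ k * coord v s    ≡⟨ regroup (coord v k) (b k) (b′ k) (coord v s) ⟩
    coord v k + (b k + b′ k) * coord v s
      ≈⟨ +-cong-≡ₚ (≡ₚ-refl {coord v k}) (*-congʳ-≡ₚ (coord v s) (b+b′≡0 k)) ⟩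
    coord v k + + 0 * coord v s                         ≡⟨ drop-zero (coord v k) (coord v s) ⟩
    coord v k                                           ∎
    where
    open ≡ₚ-Reasoning
    w : G
    w = transvection s b v
    regroup : ∀ x b b′ y → (x + b * y) + b′ * y ≡ x + (b + b′) * y
    regroup = solve-∀
    drop-zero : ∀ x y → x + + 0 * y ≡ x
    drop-zero = solve-∀
    wₛ≡vₛ : coord w s ≡ₚ coord v s
    wₛ≡vₛ = begin
      coord w s                        ≈⟨ coord-transvection s b v s ⟩
      coord v s + b s * coord v s      ≈⟨ +-cong-≡ₚ (≡ₚ-refl {coord v s}) (*-congʳ-≡ₚ (coord v s) bₛ≡0) ⟩
      coord v s + + 0 * coord v s      ≡⟨ drop-zero (coord v s) (coord v s) ⟩
      coord v s                        ∎

  transvection-0G : ∀ s b → transvection s b 0G ≡ 0G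
  transvection-0G s b = tabulate-fromℤ _ 0G λ k → ≡ₚ-reflexive (begin
    coord 0G k + b k * coord 0G s   ≡⟨ cong₂ (λ x y → x + b k * y) (coord-0G k) (coord-0G s) ⟩
    + 0 + b k * + 0                 ≡⟨ trans (ℤP.+-identityˡ (b k * + 0)) (ℤP.*-zeroʳ (b k)) ⟩
    + 0                             ≡⟨ coord-0G k ⟨
    coord 0G k                      ∎)
    where open ≡-Reasoning

  dilate : (Fin ν → ℤ) → G → G
  dilate c v = tabulate (λ k → fromℤ (c k * coord v k))

  coord-dilate : ∀ c v k → coord (dilate c v) k ≡ₚ c k * coord v k
  coord-dilate c v = coord-tabulate (λ k → c k * coord v k)

  dilate-inverse : ∀ c c′ → (∀ k → c′ k * c k ≡ₚ + 1) → ∀ v → dilate c′ (dilate c v) ≡ v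
  dilate-inverse c c′ c′c≡1 v = tabulate-fromℤ _ v λ k → begin
    c′ k * coord (dilate c v) k   ≈⟨ *-congˡ-≡ₚ (c′ k) (coord-dilate c v k) ⟩
    c′ k * (c k * coord v k)      ≡⟨ ℤP.*-assoc (c′ k) (c k) (coord v k) ⟨
    (c′ k * c k) * coord v k      ≈⟨ *-congʳ-≡ₚ (coord v k) (c′c≡1 k) ⟩
    + 1 * coord v k               ≡⟨ ℤP.*-identityˡ (coord v k) ⟩
    coord v k                     ∎
    where open ≡ₚ-Reasoning

  dilate-0G : ∀ c → dilate c 0G ≡ 0G
  dilate-0G c = tabulate-fromℤ _ 0G λ k →
    ≡ₚ-reflexive (trans (cong (c k *_) (coord-0G k)) (trans (ℤP.*-zeroʳ (c k)) (sym (coord-0G k))))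

L_G? : ∀ {n} p ν (g : Fin n → Vec (Fin p) ν) → Decidable (L_G p ν g)
L_G? p ν g x = (Σℤ (lookup x) ℤ.≟ + 0) ×-dec FinP.all? (λ k → p ℕ∣.∣? ℤ.∣ Σℤ (λ j → lookup x j ℤ.* + toℕ (lookup (g j) k)) ∣)

∣-Σℤ : ∀ {d n} {f : Fin n → ℤ} → (∀ j → d ∣ f j) → d ∣ Σℤ f
∣-Σℤ {n = ℕ.zero}  d∣f = ℤ∣.divides (+ 0) refl
∣-Σℤ {n = ℕ.suc n} d∣f = ℤ∣.∣m∣n⇒∣m+n (d∣f zero) (∣-Σℤ (d∣f ∘ suc))

p[e₀-e₁] : ∀ p n → Vec ℤ (suc (suc n))
p[e₀-e₁] p n = + p ∷ ℤ.- + p ∷ replicate n (+ 0)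

p[e₀-e₁]∈L_G : ∀ p ν n (g : Fin (suc (suc n)) → Vec (Fin p) ν) → L_G p ν g (p[e₀-e₁] p n)
p[e₀-e₁]∈L_G p ν n g = Σ≡0 , λ k → ∣⇒∣ᵤ (∣-Σℤ λ j → ℤ∣.∣m⇒∣m*n (+ toℕ (lookup (g j) k)) (p∣entry j))
  where
  p∣entry : ∀ j → + p ∣ lookup (p[e₀-e₁] p n) j
  p∣entry zero          = ℤ∣.∣-refl
  p∣entry (suc zero)    = ℤ∣.∣m⇒∣-m ℤ∣.∣-refl
  p∣entry (suc (suc j)) = subst (+ p ∣_) (sym (lookup-replicate j (+ 0))) (ℤ∣.divides (+ 0) refl)
  Σ≡0 : Σℤ (lookup (p[e₀-e₁] p n)) ≡ + 0
  Σ≡0 = begin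
    + p ℤ.+ (ℤ.- + p ℤ.+ Σℤ (lookup (replicate n (+ 0))))
      ≡⟨ cong (λ t → + p ℤ.+ (ℤ.- + p ℤ.+ t)) (trans (Σ-cong {n} (λ j → lookup-replicate j (+ 0))) (Σ-zero n)) ⟩
    + p ℤ.+ (ℤ.- + p ℤ.+ + 0)                             ≡⟨ cong (ℤ._+_ (+ p)) (ℤP.+-identityʳ (ℤ.- + p)) ⟩
    + p ℤ.+ ℤ.- + p                                       ≡⟨ ℤP.+-inverseʳ (+ p) ⟩
    + 0                                                   ∎
    where
    open ≡-Reasoning
    open Σℤ-Properties

p[e₀-e₁]≢0 : ∀ p .{{_ : ℕ.NonZero p}} n → p[e₀-e₁] p n ≢ replicate (suc (suc n)) (+ 0)
p[e₀-e₁]≢0 (suc _) n ()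

module Symmetries (p-1 ν′ N : ℕ) (g : Fin N → Vec (Fin (ℕ.suc p-1)) (ℕ.suc ν′))
                  (g-injective : Injective _≡_ _≡_ g) (g-surjective : Surjective _≡_ _≡_ g) where

  open Congruence p-1
  open AffineMaps p-1 (ℕ.suc ν′) public
  open import Data.Integer using (_+_; _*_; -_)

  ν : ℕ
  ν = ℕ.suc ν′

  Λ : Vec ℤ N → Set
  Λ = L_G p ν g

  index : G → Fin N
  index v = proj₁ (g-surjective v)

  g-index : ∀ v → g (index v) ≡ v
  g-index v = proj₂ (g-surjective v) refl

  index-g : ∀ i → index (g i) ≡ i
  index-g i = g-injective (g-index (g i))

  PreservesL : (G → G) → Set
  PreservesL F = ∀ x → Λ x → ∀ k → + p ∣ Σℤ (λ j → lookup x j * coord (F (g j)) k)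

  ∈Λ⇒∣ : ∀ x → Λ x → ∀ k → + p ∣ Σℤ (λ j → lookup x j * coord (g j) k)
  ∈Λ⇒∣ x x∈Λ k = ∣ᵤ⇒∣ (proj₂ x∈Λ k)

  weighted-Σ : ∀ (x : Vec ℤ N) (c d : ℤ) (A B : Fin N → ℤ) →
    Σℤ (λ j → lookup x j * (c * A j + d * B j)) ≡ c * Σℤ (λ j → lookup x j * A j) + d * Σℤ (λ j → lookup x j * B j)
  weighted-Σ x c d A B = begin
    Σℤ (λ j → lookup x j * (c * A j + d * B j))
      ≡⟨ Σ-cong (λ j → distribute (lookup x j) c d (A j) (B j)) ⟩
    Σℤ (λ j → c * (lookup x j * A j) + d * (lookup x j * B j))
      ≡⟨ Σ-+ (λ j → c * (lookup x j * A j)) (λ j → d * (lookup x j * B j)) ⟩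
    Σℤ (λ j → c * (lookup x j * A j)) + Σℤ (λ j → d * (lookup x j * B j))
      ≡⟨ cong₂ _+_ (Σ-*ˡ c (λ j → lookup x j * A j)) (Σ-*ˡ d (λ j → lookup x j * B j)) ⟩
    c * Σℤ (λ j → lookup x j * A j) + d * Σℤ (λ j → lookup x j * B j)  ∎
    where
    open ≡-Reasoning
    open Σℤ-Properties
    distribute : ∀ x c d a b → x * (c * a + d * b) ≡ c * (x * a) + d * (x * b)
    distribute = solve-∀

  linear-preservesL : ∀ F (c d : Fin ν → ℤ) (s : Fin ν → Fin ν) →
    (∀ v k → coord (F v) k ≡ₚ c k * coord v k + d k * coord v (s k)) → PreservesL F
  linear-preservesL F c d s F≡ x x∈Λ k = ∣-resp-≡ₚ (begin
    Σℤ (λ j → lookup x j * coord (F (g j)) k)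
      ≈⟨ Σℤ-cong-≡ₚ (λ j → *-congˡ-≡ₚ (lookup x j) (F≡ (g j) k)) ⟩
    Σℤ (λ j → lookup x j * (c k * coord (g j) k + d k * coord (g j) (s k)))
      ≡⟨ weighted-Σ x (c k) (d k) (λ j → coord (g j) k) (λ j → coord (g j) (s k)) ⟩
    c k * Σℤ (λ j → lookup x j * coord (g j) k) + d k * Σℤ (λ j → lookup x j * coord (g j) (s k)) ∎)
    (ℤ∣.∣m∣n⇒∣m+n (ℤ∣.∣n⇒∣m*n (c k) (∈Λ⇒∣ x x∈Λ k)) (ℤ∣.∣n⇒∣m*n (d k) (∈Λ⇒∣ x x∈Λ (s k))))
    where open ≡ₚ-Reasoning

  translate-preservesL : ∀ a → PreservesL (translate a)
  translate-preservesL a x x∈Λ@(Σx≡0 , _) k = ∣-resp-≡ₚ (begin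
    Σℤ (λ j → lookup x j * coord (translate a (g j)) k)
      ≈⟨ Σℤ-cong-≡ₚ (λ j → *-congˡ-≡ₚ (lookup x j) (coord-translate a (g j) k)) ⟩
    Σℤ (λ j → lookup x j * (coord (g j) k + a k))
      ≡⟨ Σ-cong (λ j → ℤP.*-distribˡ-+ (lookup x j) (coord (g j) k) (a k)) ⟩
    Σℤ (λ j → lookup x j * coord (g j) k + lookup x j * a k)
      ≡⟨ Σ-+ (λ j → lookup x j * coord (g j) k) (λ j → lookup x j * a k) ⟩
    Σℤ (λ j → lookup x j * coord (g j) k) + Σℤ (λ j → lookup x j * a k)
      ≡⟨ cong (_+_ (Σℤ (λ j → lookup x j * coord (g j) k))) (trans (Σ-*ʳ (a k) (lookup x)) (cong (_* a k) Σx≡0)) ⟩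
    Σℤ (λ j → lookup x j * coord (g j) k) + + 0 * a k ∎)
    (ℤ∣.∣m∣n⇒∣m+n (∈Λ⇒∣ x x∈Λ k) (subst (+ p ∣_) (sym (ℤP.*-zeroˡ (a k))) p∣0))
    where
    open ≡ₚ-Reasoning
    open Σℤ-Properties

  transvection-preservesL : ∀ s b → PreservesL (transvection s b)
  transvection-preservesL s b = linear-preservesL (transvection s b) (λ _ → + 1) b (λ _ → s) λ v k →
    ≡ₚ-trans (coord-transvection s b v k) (≡ₚ-reflexive (cong (_+ b k * coord v s) (sym (ℤP.*-identityˡ (coord v k)))))

  dilate-preservesL : ∀ c → PreservesL (dilate c)
  dilate-preservesL c = linear-preservesL (dilate c) c (λ _ → + 0) (λ k → k) λ v k →
    ≡ₚ-trans (coord-dilate c v k) (≡ₚ-reflexive (sym (ℤP.+-identityʳ (c k * coord v k))))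

  record Symmetry : Set where
    field
      to from         : G → G
      from-to         : ∀ v → from (to v) ≡ v
      to-from         : ∀ v → to (from v) ≡ v
      to-preservesL   : PreservesL to
      from-preservesL : PreservesL from

  translation : (Fin ν → ℤ) → Symmetry
  translation a = record
    { to = translate a ; from = translate (-_ ∘ a)
    ; from-to = translate-inverse a (-_ ∘ a) (λ k → ≡ₚ-reflexive (ℤP.+-inverseʳ (a k)))
    ; to-from = translate-inverse (-_ ∘ a) a (λ k → ≡ₚ-reflexive (ℤP.+-inverseˡ (a k)))
    ; to-preservesL = translate-preservesL a ; from-preservesL = translate-preservesL (-_ ∘ a) }

  transvectionSymmetry : ∀ s b → b s ≡ₚ + 0 → Symmetry
  transvectionSymmetry s b bₛ≡0 = record
    { to = transvection s b ; from = transvection s (-_ ∘ b)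
    ; from-to = transvection-inverse s b (-_ ∘ b) (λ k → ≡ₚ-reflexive (ℤP.+-inverseʳ (b k))) bₛ≡0
    ; to-from = transvection-inverse s (-_ ∘ b) b (λ k → ≡ₚ-reflexive (ℤP.+-inverseˡ (b k))) (-bₛ≡0)
    ; to-preservesL = transvection-preservesL s b ; from-preservesL = transvection-preservesL s (-_ ∘ b) }
    where
    -bₛ≡0 : - b s ≡ₚ + 0
    -bₛ≡0 = neg-cong-≡ₚ bₛ≡0

  dilation : ∀ c c′ → (∀ k → c′ k * c k ≡ₚ + 1) → Symmetry
  dilation c c′ c′c≡1 = record
    { to = dilate c ; from = dilate c′
    ; from-to = dilate-inverse c c′ c′c≡1
    ; to-from = dilate-inverse c′ c (λ k → ≡ₚ-trans (≡ₚ-reflexive (ℤP.*-comm (c k) (c′ k))) (c′c≡1 k))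
    ; to-preservesL = dilate-preservesL c ; from-preservesL = dilate-preservesL c′ }

  permute-preservesL : ∀ π F → (∀ j → g (flip π ⟨$⟩ʳ j) ≡ F (g j)) → PreservesL F → Λ PreservedBy π
  permute-preservesL π F g∘π⁻¹≡F∘g F-preserves x x∈Λ@(Σx≡0 , _) = Σπx≡0 , λ k → ∣⇒∣ᵤ (subst (+ p ∣_) (reindex k) (F-preserves x x∈Λ k))
    where
    open ≡-Reasoning
    open Σℤ-Properties
    Σπx≡0 : Σℤ (lookup (permute π x)) ≡ + 0
    Σπx≡0 = begin
      Σℤ (lookup (permute π x))          ≡⟨ Σ-cong (lookup-permute π x) ⟩
      Σℤ (λ k → lookup x (π ⟨$⟩ʳ k))     ≡⟨ Σ-permute (lookup x) π ⟨
      Σℤ (lookup x)                      ≡⟨ Σx≡0 ⟩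
      + 0                                ∎
    reindex : ∀ k → Σℤ (λ j → lookup x j * coord (F (g j)) k) ≡ Σℤ (λ j → lookup (permute π x) j * coord (g j) k)
    reindex k = begin
      Σℤ (λ j → lookup x j * coord (F (g j)) k)
        ≡⟨ Σ-cong (λ j → cong (λ v → lookup x j * coord v k) (sym (g∘π⁻¹≡F∘g j))) ⟩
      Σℤ (λ j → lookup x j * coord (g (flip π ⟨$⟩ʳ j)) k)                         ≡⟨ Σ-permute _ π ⟩
      Σℤ (λ j → lookup x (π ⟨$⟩ʳ j) * coord (g (flip π ⟨$⟩ʳ (π ⟨$⟩ʳ j))) k)
        ≡⟨ Σ-cong (λ j → cong₂ (λ a v → a * coord (g v) k) (sym (lookup-permute π x j)) (inverseˡ π)) ⟩
      Σℤ (λ j → lookup (permute π x) j * coord (g j) k)                          ∎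

  module _ (σ : Symmetry) where

    open Symmetry σ

    indexPermutation : Permutation N N
    indexPermutation = permutation (index ∘ to ∘ g) (index ∘ from ∘ g) (round-trip to from to-from) (round-trip from to from-to)
      where
      round-trip : ∀ F F′ → (∀ v → F (F′ v) ≡ v) → ∀ i → index (F (g (index (F′ (g i))))) ≡ i
      round-trip F F′ F∘F′≡id i = trans (cong (index ∘ F) (g-index (F′ (g i)))) (trans (cong index (F∘F′≡id (g i))) (index-g i))

    gram-invariant : ∀ {m S} → IsMinimalVectors Λ m S → ∀ u w →
                     gram S (index u) (index w) ≡ gram S (index (to u)) (index (to w))
    gram-invariant {S = S} minimal u w = trans
      (gram-permute minimal indexPermutation
        (permute-preservesL indexPermutation from (λ j → g-index (from (g j))) from-preservesL)
        (permute-preservesL (flip indexPermutation) to (λ j → g-index (to (g j))) to-preservesL)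
        (index u) (index w))
      (cong₂ (λ u w → gram S (index (to u)) (index (to w))) (g-index u) (g-index w))

  module TwoTransitivity (p-prime : Prime p) {A : Set} (f : G → G → A)
                         (invariant : ∀ σ u w → f u w ≡ f (Symmetry.to σ u) (Symmetry.to σ w)) where

    open Symmetry

    one : Fin p
    one = fromℤ (+ 1)

    e₀ : G
    e₀ = 0G [ zero ]≔ one

    coord-e₀-zero : coord e₀ zero ≡ₚ + 1
    coord-e₀-zero = subst (λ u → toℤ u ≡ₚ + 1) (sym (lookup∘update zero 0G one)) (toℤ-fromℤ (+ 1))

    coord-e₀-suc : ∀ k → coord e₀ (suc k) ≡ + 0
    coord-e₀-suc k = trans (cong toℤ (lookup∘update′ {i = suc k} {j = zero} (λ ()) 0G one)) (coord-0G (suc k))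

    h : G → A
    h = f 0G

    h-invariant : ∀ σ → to σ 0G ≡ 0G → ∀ z → h z ≡ h (to σ z)
    h-invariant σ σ0≡0 z = trans (invariant σ 0G z) (cong (λ u → f u (to σ z)) σ0≡0)

    nonzero-coordinate : ∀ z → z ≢ 0G → ∃ λ r → lookup z r ≢ zero
    nonzero-coordinate z z≢0 = FinP.¬∀⟶∃¬ _ (λ r → lookup z r ≡ zero) (λ r → lookup z r FinP.≟ zero)
      (λ z≡0 → z≢0 (Pointwise-≡⇒≡ (ext λ r → trans (z≡0 r) (sym (lookup-replicate r zero)))))

    first-nonzero : ∀ z → z ≢ 0G → ∃ λ z′ → h z ≡ h z′ × lookup z′ zero ≢ zero
    first-nonzero z z≢0 with lookup z zero FinP.≟ zero | nonzero-coordinate z z≢0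
    ... | no z₀≢0  | _             = z , refl , z₀≢0
    ... | yes z₀≡0 | zero  , z₀≢0  = contradiction z₀≡0 z₀≢0
    ... | yes z₀≡0 | suc r , zᵣ≢0  = z′ , h-invariant σ (transvection-0G (suc r) (coord e₀)) z , zᵣ≢0 ∘ trans (sym z′₀≡zᵣ)
      where
      open ≡ₚ-Reasoning
      σ : Symmetry
      σ = transvectionSymmetry (suc r) (coord e₀) (≡ₚ-reflexive (coord-e₀-suc r))
      z′ : G
      z′ = transvection (suc r) (coord e₀) z
      z′₀≡zᵣ : lookup z′ zero ≡ lookup z (suc r)
      z′₀≡zᵣ = toℤ-injective-≡ₚ (begin
        coord z′ zero                                  ≈⟨ coord-transvection (suc r) (coord e₀) z zero ⟩
        coord z zero + coord e₀ zero * coord z (suc r) ≡⟨ cong (λ u → toℤ u + coord e₀ zero * coord z (suc r)) z₀≡0 ⟩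
        + 0 + coord e₀ zero * coord z (suc r)
          ≈⟨ +-cong-≡ₚ (≡ₚ-refl {+ 0}) (*-congʳ-≡ₚ (coord z (suc r)) coord-e₀-zero) ⟩
        + 0 + + 1 * coord z (suc r)
          ≡⟨ trans (ℤP.+-identityˡ (+ 1 * coord z (suc r))) (ℤP.*-identityˡ (coord z (suc r))) ⟩
        coord z (suc r)                                ∎)

    first-one : ∀ z → lookup z zero ≢ zero → ∃ λ z′ → h z ≡ h z′ × lookup z′ zero ≡ one
    first-one z z₀≢0 with inverse-≡ₚ p-prime (lookup z zero) z₀≢0
    ... | c , cz₀≡1 = dilate factor z , h-invariant σ (dilate-0G factor) z , z′₀≡1
      where
      factor cofactor : Fin ν → ℤ
      factor zero      = c
      factor (suc _)   = + 1
      cofactor zero    = coord z zero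
      cofactor (suc _) = + 1
      cofactor*factor≡1 : ∀ k → cofactor k * factor k ≡ₚ + 1
      cofactor*factor≡1 zero    = ≡ₚ-trans (≡ₚ-reflexive (ℤP.*-comm (coord z zero) c)) cz₀≡1
      cofactor*factor≡1 (suc _) = ≡ₚ-refl
      σ : Symmetry
      σ = dilation factor cofactor cofactor*factor≡1
      z′₀≡1 : lookup (dilate factor z) zero ≡ one
      z′₀≡1 = trans (lookup∘tabulate (λ k → fromℤ (factor k * coord z k)) zero) (fromℤ-cong cz₀≡1)

    first-one⇒≡e₀ : ∀ z → lookup z zero ≡ one → h z ≡ h e₀
    first-one⇒≡e₀ z z₀≡1 = trans (h-invariant σ (transvection-0G zero b) z) (cong h (tabulate-fromℤ _ e₀ cleared))
      where
      open ≡ₚ-Reasoning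
      b : Fin ν → ℤ
      b zero    = + 0
      b (suc k) = - coord z (suc k)
      σ : Symmetry
      σ = transvectionSymmetry zero b ≡ₚ-refl
      z₀≡ₚ1 : coord z zero ≡ₚ + 1
      z₀≡ₚ1 = subst (λ u → toℤ u ≡ₚ + 1) (sym z₀≡1) (toℤ-fromℤ (+ 1))
      drop-zero : ∀ x → x + + 0 * x ≡ x
      drop-zero = solve-∀
      vanish : ∀ x → x + - x * + 1 ≡ + 0
      vanish = solve-∀
      cleared : ∀ k → coord z k + b k * coord z zero ≡ₚ coord e₀ k
      cleared zero = begin
        coord z zero + + 0 * coord z zero   ≡⟨ drop-zero (coord z zero) ⟩
        coord z zero                        ≈⟨ z₀≡ₚ1 ⟩
        + 1                                 ≈⟨ coord-e₀-zero ⟨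
        coord e₀ zero                       ∎
      cleared (suc k) = begin
        coord z (suc k) + - coord z (suc k) * coord z zero
          ≈⟨ +-cong-≡ₚ (≡ₚ-refl {coord z (suc k)}) (*-congˡ-≡ₚ (- coord z (suc k)) z₀≡ₚ1) ⟩
        coord z (suc k) + - coord z (suc k) * + 1           ≡⟨ vanish (coord z (suc k)) ⟩
        + 0                                                 ≡⟨ coord-e₀-suc k ⟨
        coord e₀ (suc k)                                    ∎

    h-nonzero : ∀ z → z ≢ 0G → h z ≡ h e₀
    h-nonzero z z≢0 =
      let (z′ , hz≡hz′ , z′₀≢0)   = first-nonzero z z≢0
          (z″ , hz′≡hz″ , z″₀≡1)  = first-one z′ z′₀≢0
      in trans hz≡hz′ (trans hz′≡hz″ (first-one⇒≡e₀ z″ z″₀≡1))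

    f-diagonal : ∀ u → f u u ≡ f 0G 0G
    f-diagonal u = trans (invariant (translation (-_ ∘ coord u)) u u) (cong₂ f (translate-to-0G u) (translate-to-0G u))

    f-off-diagonal : ∀ u w → u ≢ w → f u w ≡ f 0G e₀
    f-off-diagonal u w u≢w = begin
      f u w              ≡⟨ invariant σ u w ⟩
      f (to σ u) (to σ w) ≡⟨ cong (λ v → f v (to σ w)) (translate-to-0G u) ⟩
      h (to σ w)         ≡⟨ h-nonzero (to σ w) σw≢0G ⟩
      h e₀               ∎
      where
      open ≡-Reasoning
      σ : Symmetry
      σ = translation (-_ ∘ coord u)
      σw≢0G : to σ w ≢ 0G
      σw≢0G σw≡0G = u≢w (begin
        u                  ≡⟨ from-to σ u ⟨
        from σ (to σ u)    ≡⟨ cong (from σ) (trans (translate-to-0G u) (sym σw≡0G)) ⟩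
        from σ (to σ w)    ≡⟨ from-to σ w ⟩
        w                  ∎)

  module GramOfL_G (p-prime : Prime p) {m : ℤ} {S : List (Vec ℤ N)} (minimal : IsMinimalVectors Λ m S) where

    gramG : G → G → ℚ
    gramG u w = gram S (index u) (index w)

    open TwoTransitivity p-prime gramG (λ σ → gram-invariant σ minimal)

    gram≡gramG : ∀ i j → gram S i j ≡ gramG (g i) (g j)
    gram≡gramG i j = sym (cong₂ (gram S) (index-g i) (index-g j))

    gram-diagonal : ∀ i → gram S i i ≡ gramG 0G 0G
    gram-diagonal i = trans (gram≡gramG i i) (f-diagonal (g i))

    gram-off-diagonal : ∀ i j → i ≢ j → gram S i j ≡ gramG 0G e₀
    gram-off-diagonal i j i≢j = trans (gram≡gramG i j) (f-off-diagonal (g i) (g j) (i≢j ∘ g-injective))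

theorem2p3 : (p ν n : ℕ) → Prime p → 1 ≤ ν → suc n ≡ p ^ ν →
    (g : Fin (suc n) → Vec (Fin p) ν) → Bijective _≡_ _≡_ g →
    (∀ (k : Fin ν) → toℕ (lookup (g zero) k) ≡ 0) →
    StronglyEutactic (L_G p ν g) n SumZero
theorem2p3 ℕ.zero    _        _      ()
theorem2p3 (suc p-1) ℕ.zero   _      _       ()
theorem2p3 (suc p-1) (suc ν′) ℕ.zero p-prime _ 1≡p^ν _ _ _ with ℕP.m^n≡1⇒n≡0∨m≡1 (suc p-1) (suc ν′) (sym 1≡p^ν)
... | inj₁ ()
... | inj₂ refl = contradiction p-prime ¬prime[1]
theorem2p3 (suc p-1) (suc ν′) (suc n) p-prime _ _ g (g-injective , g-surjective) _ =
  m , S , isMinimalVectors , strongly-eutactic m _ _ normSq≡m Σ≡0 gram-diagonal gram-off-diagonal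
  where
  open ShortestVectors (L_G? (suc p-1) (suc ν′) g) (p[e₀-e₁]∈L_G (suc p-1) (suc ν′) n g) (p[e₀-e₁]≢0 (suc p-1) n)
  open StrongEutaxyCriterion S
  open Symmetries p-1 ν′ (suc (suc n)) g g-injective g-surjective
  open GramOfL_G p-prime isMinimalVectors
  normSq≡m : ∀ x → x ∈ S → normSq x ≡ m
  normSq≡m x = proj₂ ∘ proj₂ ∘ Equivalence.to (∈S⇔ x)
  Σ≡0 : ∀ x → x ∈ S → Σℤ (lookup x) ≡ + 0
  Σ≡0 x = proj₁ ∘ proj₁ ∘ Equivalence.to (∈S⇔ x)
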